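{- Let $m,t,w\in\mathbb{N}_+$ and $\varepsilon>0$. Let $X=(X_1,\dots,X_m)$ and $Y=(Y_1,\dots,Y_m)$ be independent random variables with values in $(\{0,1\}^t)^m$ such that each of $X$ and $Y$ $m$-simultaneously $\varepsilon$-fools width-$w$, length-$t$ unanimity programs. Then the random variable $X\,\|\,Y = X_1Y_1X_2Y_2\cdots X_mY_m\in\{0,1\}^{2tm}$ $2\varepsilon$-fools width-$w$, length-$2tm$ SWBPs of window size $t$, i.e. for every such SWBP $S$, $|\Pr[S(X\,\|\,Y)=1]-\Pr[S(U_{2tm})=1]|\le2\varepsilon$.
   Context: A branching program of length $n$ and width $w$: state set $Q$, $|Q|=w$, initial state $q_0$, transition functions $P_1,\dots,P_n\colon Q\times\{0,1\}\to Q$, reading $x\in\{0,1\}^n$ left to right. $Q_i$ is the set of states reachable after exactly $i$ steps; for $q\in Q_i$ and $|y|\le n-i$, $S_i(q,y)$ is the state reached from $q$ at layer $i$ after reading $y$. A unanimity program additionally has accepting subsets $Q^i_{\mathrm{acc}}\subseteq Q_i$ and outputs 1 on $x$ iff after every nonempty prefix $y$ of $x$ the current state is in $Q^{|y|}_{\mathrm{acc}}$. An SWBP of window size $t$ is a unanimity program with $S_i(q,y)=S_i(q',y)$ for all $i\le n-t$, $y\in\{0,1\}^t$, $q,q'\in Q_i$. A distribution $X=(X_1,\dots,X_m)$ on $(\{0,1\}^t)^m$ $m$-simultaneously $\varepsilon$-fools a class $\mathcal{F}$ of functions $\{0,1\}^t\to\{0,1\}$ if for all $f_1,\dots,f_m\in\mathcal{F}$: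 $|\Pr[\forall i: f_i(X_i)=1]-\prod_i\Pr[f_i(U_t)=1]|\le\varepsilon$, $U_k$ uniform on $\{0,1\}^k$.
   Formalization: The random variables X and Y have rational point probabilities, and ε is a positive rational. -}

module Defs where

open import Data.Bool using (Bool; true; false; _∧_; if_then_else_)
open import Data.Nat as ℕ using (ℕ; zero; suc; _^_)
open import Data.Nat.Properties using (m^n≢0)
open import Data.Fin using (Fin)
open import Data.Vec using (Vec; []; _∷_; _++_; lookup)
open import Data.List using (List; []; _∷_; concatMap; map)
open import Data.Integer using (+_)
open import Data.Rational using (ℚ; 0ℚ; 1ℚ; _+_; _*_; _/_; _≤_; _-_; ∣_∣)
open import Data.Product using (Σ; _×_; ∃)
open import Relation.Binary.PropositionalEquality using (_≡_)

Bits : ℕ → Set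
Bits t = Vec Bool t

vecs : {A : Set} → List A → (m : ℕ) → List (Vec A m)
vecs as zero    = [] ∷ []
vecs as (suc m) = concatMap (λ a → map (a ∷_) (vecs as m)) as

allBits : (t : ℕ) → List (Bits t)
allBits t = vecs (true ∷ false ∷ []) t

allBlocks : (t m : ℕ) → List (Vec (Bits t) m)
allBlocks t m = vecs (allBits t) m

sumℚ : List ℚ → ℚ
sumℚ []       = 0ℚ
sumℚ (q ∷ qs) = q + sumℚ qs

prodℚ : {m : ℕ} → Vec ℚ m → ℚ
prodℚ []       = 1ℚ
prodℚ (q ∷ qs) = q * prodℚ qs

indicator : Bool → ℚ
indicator b = if b then 1ℚ else 0ℚ

record Dist (A : Set) (univ : List A) : Set where
  field
    mass    : A → ℚ
    nonneg  : ∀ a → 0ℚ ≤ mass a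
    total   : sumℚ (map mass univ) ≡ 1ℚ

Pr : {A : Set} (univ : List A) → (A → ℚ) → (A → Bool) → ℚ
Pr univ μ f = sumℚ (map (λ a → μ a * indicator (f a)) univ)

PrU : (t : ℕ) → (Bits t → Bool) → ℚ
PrU t f = Pr (allBits t) (λ _ → _/_ (+ 1) (2 ^ t) {{m^n≢0 2 t}}) f

-- States Q = Fin w, layers numbered 0,1,2,…; step i (reading the
-- (i+1)-st bit, 0-based layer i → i+1) uses transition P i.
-- acc j is the accepting set of layer j (used for j ≥ 1).

record UProg (w : ℕ) : Set where
  field
    q₀  : Fin w
    P   : ℕ → Fin w → Bool → Fin w
    acc : ℕ → Fin w → Bool
open UProg public

S : {w k : ℕ} → UProg w → ℕ → Fin w → Bits k → Fin w
S B i q []      = q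
S B i q (b ∷ y) = S B (suc i) (P B i q b) y

Reach : {w : ℕ} → UProg w → ℕ → Fin w → Set
Reach B i q = Σ (Bits i) (λ x → S B 0 (q₀ B) x ≡ q)

accFrom : {w k : ℕ} → UProg w → ℕ → Fin w → Bits k → Bool
accFrom B i q []      = true
accFrom B i q (b ∷ y) = acc B (suc i) (P B i q b) ∧ accFrom B (suc i) (P B i q b) y

run : {w n : ℕ} → UProg w → Bits n → Bool
run B x = accFrom B 0 (q₀ B) x

IsSWBP : {w : ℕ} → (n t : ℕ) → UProg w → Set
IsSWBP {w} n t B =
  ∀ (i : ℕ) → i ℕ.+ t ℕ.≤ n → (y : Bits t) → (q q' : Fin w) →
  Reach B i q → Reach B i q' → S B i q y ≡ S B i q' y

allTrue : {t m : ℕ} {w : ℕ} → Vec (UProg w) m → Vec (Bits t) m → Bool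
allTrue []       []       = true
allTrue (f ∷ fs) (x ∷ xs) = run f x ∧ allTrue fs xs

prodU : {m : ℕ} {w : ℕ} (t : ℕ) → Vec (UProg w) m → ℚ
prodU t []       = 1ℚ
prodU t (f ∷ fs) = PrU t (run f) * prodU t fs

Close : ℚ → ℚ → ℚ → Set
Close a b ε = ∣ a - b ∣ ≤ ε

SimFools : (m t w : ℕ) → Dist (Vec (Bits t) m) (allBlocks t m) → ℚ → Set
SimFools m t w X ε =
  (fs : Vec (UProg w) m) →
  Close (Pr (allBlocks t m) (Dist.mass X) (allTrue fs)) (prodU t fs) ε

interleave : {t m : ℕ} → Vec (Bits t) m → Vec (Bits t) m → Bits (m ℕ.* (t ℕ.+ t))
interleave []       []       = []
interleave (x ∷ xs) (y ∷ ys) = (x ++ y) ++ interleave xs ys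

PrInterleave : {t m : ℕ} → Dist (Vec (Bits t) m) (allBlocks t m) →
               Dist (Vec (Bits t) m) (allBlocks t m) →
               (Bits (m ℕ.* (t ℕ.+ t)) → Bool) → ℚ
PrInterleave {t} {m} X Y f =
  sumℚ (map (λ a → sumℚ (map (λ b →
      Dist.mass X a * Dist.mass Y b * indicator (f (interleave a b)))
    (allBlocks t m))) (allBlocks t m))

module Submission where

-- Hybrid argument: Pr[B(X ‖ Y)] ≈ε Pr[B(U ‖ Y)] ≈ε Pr[B(U ‖ U)], and U ‖ U is uniform on
-- {0,1}^{2tm}.  By the window property the state of B at the start of a length-t block
-- depends only on the preceding block.  So once the Y-blocks are fixed, B(x₁y₁⋯xₘyₘ) is the
-- conjunction of m width-w unanimity programs, the k-th reading xₖ from a state fixed by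
-- y_{k-1} and checking at its end that yₖ is accepted; X fools such a conjunction, and
-- averaging over Y keeps the error ε.  The same holds with the roles of X and Y exchanged,
-- up to the fixed factor "x₁ is accepted".

open import Defs
open import Data.Bool using (Bool; true; false; _∧_; if_then_else_)
open import Data.Bool.Properties using (∧-assoc; ∧-identityʳ)
open import Data.Fin using (Fin)
open import Data.Integer using (+_)
open import Data.List as List using (List; []; _∷_; map; concatMap)
open import Data.Nat as ℕ using (ℕ; zero; suc; NonZero; _^_)
open import Data.Nat.Coprimality using (1-coprimeTo)
open import Data.Nat.Properties using (m^n≢0; m*n≢0)
import Data.Nat.Properties as ℕₚ
open import Data.Product using (_,_)
open import Data.Rational
  using (ℚ; 0ℚ; 1ℚ; ½; _+_; _*_; _-_; _/_; _≤_; ∣_∣; nonNegative; Positive)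
open import Data.Rational.Properties
open import Data.Rational.Solver using (module +-*-Solver)
open import Data.Vec using (Vec; []; _∷_; _++_; replicate)
open import Relation.Binary.PropositionalEquality
open import Relation.Nullary.Decidable using (does; dec-true; dec-false)
open +-*-Solver

private
  variable
    A A′ : Set

-- Finite sums

∑ : List A → (A → ℚ) → ℚ
∑ l f = sumℚ (map f l)

∑-cong : ∀ (l : List A) {f g : A → ℚ} → (∀ a → f a ≡ g a) → ∑ l f ≡ ∑ l g
∑-cong []      f≡g = refl
∑-cong (a ∷ l) f≡g = cong₂ _+_ (f≡g a) (∑-cong l f≡g)

∑-++ : ∀ (l₁ l₂ : List A) f → ∑ (l₁ List.++ l₂) f ≡ ∑ l₁ f + ∑ l₂ f
∑-++ []       l₂ f = sym (+-identityˡ (∑ l₂ f))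
∑-++ (a ∷ l₁) l₂ f = trans (cong (_+_ (f a)) (∑-++ l₁ l₂ f)) (sym (+-assoc (f a) _ _))

∑-map : ∀ (h : A′ → A) (l : List A′) f → ∑ (map h l) f ≡ ∑ l (λ b → f (h b))
∑-map h []      f = refl
∑-map h (b ∷ l) f = cong (_+_ (f (h b))) (∑-map h l f)

∑-concatMap : ∀ (h : A′ → List A) (l : List A′) f → ∑ (concatMap h l) f ≡ ∑ l (λ b → ∑ (h b) f)
∑-concatMap h []      f = refl
∑-concatMap h (b ∷ l) f =
  trans (∑-++ (h b) (concatMap h l) f) (cong (_+_ (∑ (h b) f)) (∑-concatMap h l f))

∑-zero : ∀ (l : List A) → ∑ l (λ _ → 0ℚ) ≡ 0ℚ
∑-zero []      = refl
∑-zero (a ∷ l) = trans (+-identityˡ _) (∑-zero l)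

∑-+ : ∀ (l : List A) f g → ∑ l (λ a → f a + g a) ≡ ∑ l f + ∑ l g
∑-+ []      f g = refl
∑-+ (a ∷ l) f g = trans (cong (_+_ (f a + g a)) (∑-+ l f g))
  (solve 4 (λ x y u v → (x :+ y) :+ (u :+ v) := (x :+ u) :+ (y :+ v)) refl
     (f a) (g a) (∑ l f) (∑ l g))

∑-- : ∀ (l : List A) f g → ∑ l (λ a → f a - g a) ≡ ∑ l f - ∑ l g
∑-- []      f g = refl
∑-- (a ∷ l) f g = trans (cong (_+_ (f a - g a)) (∑-- l f g))
  (solve 4 (λ x y u v → (x :- y) :+ (u :- v) := (x :+ u) :- (y :+ v)) refl
     (f a) (g a) (∑ l f) (∑ l g))

∑-*ˡ : ∀ (l : List A) c f → ∑ l (λ a → c * f a) ≡ c * ∑ l f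
∑-*ˡ []      c f = sym (*-zeroʳ c)
∑-*ˡ (a ∷ l) c f = trans (cong (_+_ (c * f a)) (∑-*ˡ l c f)) (sym (*-distribˡ-+ c (f a) _))

∑-swap : ∀ (l₁ : List A) (l₂ : List A′) (f : A → A′ → ℚ) →
         ∑ l₁ (λ a → ∑ l₂ (f a)) ≡ ∑ l₂ (λ b → ∑ l₁ (λ a → f a b))
∑-swap []       l₂ f = sym (∑-zero l₂)
∑-swap (a ∷ l₁) l₂ f = trans (cong (_+_ (∑ l₂ (f a))) (∑-swap l₁ l₂ f)) (sym (∑-+ l₂ (f a) _))

∑-vecs-suc : ∀ (l : List A) m (F : Vec A (suc m) → ℚ) →
             ∑ (vecs l (suc m)) F ≡ ∑ l (λ a → ∑ (vecs l m) (λ v → F (a ∷ v)))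
∑-vecs-suc l m F = trans (∑-concatMap _ l F) (∑-cong l (λ a → ∑-map (a ∷_) (vecs l m) F))

∣∑μh∣≤∑μ*ε : ∀ (l : List A) (μ h : A → ℚ) {ε} → (∀ a → 0ℚ ≤ μ a) → (∀ a → ∣ h a ∣ ≤ ε) →
             ∣ ∑ l (λ a → μ a * h a) ∣ ≤ ∑ l μ * ε
∣∑μh∣≤∑μ*ε []      μ h {ε} μ≥0 h≤ε = ≤-reflexive (sym (*-zeroˡ ε))
∣∑μh∣≤∑μ*ε (a ∷ l) μ h {ε} μ≥0 h≤ε = begin
  ∣ μ a * h a + ∑ l (λ a → μ a * h a) ∣      ≤⟨ ∣p+q∣≤∣p∣+∣q∣ (μ a * h a) _ ⟩
  ∣ μ a * h a ∣ + ∣ ∑ l (λ a → μ a * h a) ∣  ≤⟨ +-mono-≤ head≤ (∣∑μh∣≤∑μ*ε l μ h μ≥0 h≤ε) ⟩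
  μ a * ε + ∑ l μ * ε                        ≡⟨ *-distribʳ-+ ε (μ a) (∑ l μ) ⟨
  (μ a + ∑ l μ) * ε                          ∎
  where
  open ≤-Reasoning
  head≤ : ∣ μ a * h a ∣ ≤ μ a * ε
  head≤ = begin
    ∣ μ a * h a ∣      ≡⟨ ∣p*q∣≡∣p∣*∣q∣ (μ a) (h a) ⟩
    ∣ μ a ∣ * ∣ h a ∣  ≡⟨ cong (_* ∣ h a ∣) (0≤p⇒∣p∣≡p (μ≥0 a)) ⟩
    μ a * ∣ h a ∣      ≤⟨ *-monoˡ-≤-nonNeg (μ a) {{nonNegative (μ≥0 a)}} (h≤ε a) ⟩
    μ a * ε            ∎

-- Expectations and closeness

𝔼 : {l : List A} → Dist A l → (A → ℚ) → ℚ
𝔼 {l = l} D F = ∑ l (λ a → Dist.mass D a * F a)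

module _ {l : List A} (D : Dist A l) where

  private
    μ = Dist.mass D

  𝔼-cong : ∀ {F G : A → ℚ} → (∀ a → F a ≡ G a) → 𝔼 D F ≡ 𝔼 D G
  𝔼-cong F≡G = ∑-cong l (λ a → cong (μ a *_) (F≡G a))

  𝔼-*ˡ : ∀ c F → 𝔼 D (λ a → c * F a) ≡ c * 𝔼 D F
  𝔼-*ˡ c F = trans (∑-cong l (λ a → solve 3 (λ m c f → m :* (c :* f) := c :* (m :* f)) refl (μ a) c (F a)))
                   (∑-*ˡ l c _)

  𝔼-*ʳ : ∀ c F → 𝔼 D (λ a → F a * c) ≡ 𝔼 D F * c
  𝔼-*ʳ c F = trans (𝔼-cong (λ a → *-comm (F a) c)) (trans (𝔼-*ˡ c F) (*-comm c (𝔼 D F)))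

  𝔼-zero : 𝔼 D (λ _ → 0ℚ) ≡ 0ℚ
  𝔼-zero = trans (∑-cong l (λ a → *-zeroʳ (μ a))) (∑-zero l)

  𝔼-- : ∀ F G → 𝔼 D F - 𝔼 D G ≡ 𝔼 D (λ a → F a - G a)
  𝔼-- F G = trans (sym (∑-- l _ _))
    (∑-cong l (λ a → solve 3 (λ m f g → m :* f :- m :* g := m :* (f :- g)) refl (μ a) (F a) (G a)))

  𝔼-close : ∀ {F G : A → ℚ} {ε} → (∀ a → Close (F a) (G a) ε) → Close (𝔼 D F) (𝔼 D G) ε
  𝔼-close {F} {G} {ε} F≈G = begin
    ∣ 𝔼 D F - 𝔼 D G ∣          ≡⟨ cong ∣_∣ (𝔼-- F G) ⟩
    ∣ 𝔼 D (λ a → F a - G a) ∣  ≤⟨ ∣∑μh∣≤∑μ*ε l μ _ (Dist.nonneg D) F≈G ⟩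
    ∑ l μ * ε                  ≡⟨ cong (_* ε) (Dist.total D) ⟩
    1ℚ * ε                     ≡⟨ *-identityˡ ε ⟩
    ε                          ∎
    where open ≤-Reasoning

𝔼-swap : ∀ {l₁ : List A} {l₂ : List A′} (D₁ : Dist A l₁) (D₂ : Dist A′ l₂) (F : A → A′ → ℚ) →
         𝔼 D₁ (λ a → 𝔼 D₂ (F a)) ≡ 𝔼 D₂ (λ b → 𝔼 D₁ (λ a → F a b))
𝔼-swap {l₁ = l₁} {l₂} D₁ D₂ F = begin
  ∑ l₁ (λ a → μ a * ∑ l₂ (λ b → ν b * F a b))
    ≡⟨ ∑-cong l₁ (λ a → sym (∑-*ˡ l₂ (μ a) _)) ⟩
  ∑ l₁ (λ a → ∑ l₂ (λ b → μ a * (ν b * F a b)))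
    ≡⟨ ∑-swap l₁ l₂ _ ⟩
  ∑ l₂ (λ b → ∑ l₁ (λ a → μ a * (ν b * F a b)))
    ≡⟨ ∑-cong l₂ (λ b → ∑-cong l₁ (λ a → exchange (μ a) (ν b) (F a b))) ⟩
  ∑ l₂ (λ b → ∑ l₁ (λ a → ν b * (μ a * F a b)))
    ≡⟨ ∑-cong l₂ (λ b → ∑-*ˡ l₁ (ν b) _) ⟩
  ∑ l₂ (λ b → ν b * ∑ l₁ (λ a → μ a * F a b))
    ∎
  where
  open ≡-Reasoning
  μ = Dist.mass D₁
  ν = Dist.mass D₂
  exchange : ∀ x y z → x * (y * z) ≡ y * (x * z)
  exchange = solve 3 (λ x y z → x :* (y :* z) := y :* (x :* z)) refl

Close-trans : ∀ {p q r ε δ} → Close p q ε → Close q r δ → Close p r (ε + δ)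
Close-trans {p} {q} {r} {ε} {δ} p≈q q≈r = begin
  ∣ p - r ∣              ≡⟨ cong ∣_∣ (solve 3 (λ p q r → p :- r := (p :- q) :+ (q :- r)) refl p q r) ⟩
  ∣ (p - q) + (q - r) ∣  ≤⟨ ∣p+q∣≤∣p∣+∣q∣ (p - q) (q - r) ⟩
  ∣ p - q ∣ + ∣ q - r ∣  ≤⟨ +-mono-≤ p≈q q≈r ⟩
  ε + δ                  ∎
  where open ≤-Reasoning

hybrid : ∀ {l₁ : List A} {l₂ : List A′} (X U : Dist A l₁) (Y V : Dist A′ l₂) (g : A → A′ → ℚ) {ε δ} →
         (∀ b → Close (𝔼 X (λ a → g a b)) (𝔼 U (λ a → g a b)) ε) →
         (∀ a → Close (𝔼 Y (g a)) (𝔼 V (g a)) δ) →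
         Close (𝔼 X (λ a → 𝔼 Y (g a))) (𝔼 U (λ a → 𝔼 V (g a))) (ε + δ)
hybrid X U Y V g {ε} X≈U Y≈V = Close-trans {XY} {UY} {UV} XY≈UY (𝔼-close U Y≈V)
  where
  XY = 𝔼 X (λ a → 𝔼 Y (g a))
  UY = 𝔼 U (λ a → 𝔼 Y (g a))
  UV = 𝔼 U (λ a → 𝔼 V (g a))
  XY≈UY : Close XY UY ε
  XY≈UY = subst₂ (λ p q → Close p q ε) (sym (𝔼-swap X Y g)) (sym (𝔼-swap U Y g)) (𝔼-close Y X≈U)

𝔼-close-∧ : ∀ {l₁ l₂ : List A} (D₁ : Dist A l₁) (D₂ : Dist A l₂) {f : A → Bool} {ε} →
            0ℚ ≤ ε → ∀ c →
            Close (𝔼 D₁ (λ a → indicator (f a))) (𝔼 D₂ (λ a → indicator (f a))) ε →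
            Close (𝔼 D₁ (λ a → indicator (c ∧ f a))) (𝔼 D₂ (λ a → indicator (c ∧ f a))) ε
𝔼-close-∧ D₁ D₂ ε≥0 true  D₁≈D₂ = D₁≈D₂
𝔼-close-∧ D₁ D₂ ε≥0 false _     =
  subst₂ (λ p q → Close p q _) (sym (𝔼-zero D₁)) (sym (𝔼-zero D₂)) ε≥0

-- Independent samples and the uniform distribution

productMass : ∀ {m} → (A → ℚ) → Vec A m → ℚ
productMass μ []      = 1ℚ
productMass μ (a ∷ v) = μ a * productMass μ v

module _ {l : List A} (D : Dist A l) where

  private
    μ = Dist.mass D

  productMass-nonneg : ∀ {m} (v : Vec A m) → 0ℚ ≤ productMass μ v
  productMass-nonneg []      = nonNegative⁻¹ 1ℚ
  productMass-nonneg (a ∷ v) = nonNegative⁻¹ _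
    {{nonNeg*nonNeg⇒nonNeg (μ a) {{nonNegative (Dist.nonneg D a)}} _ {{nonNegative (productMass-nonneg v)}}}}

  productMass-total : ∀ m → ∑ (vecs l m) (productMass μ) ≡ 1ℚ
  productMass-total zero    = refl
  productMass-total (suc m) = begin
    ∑ (vecs l (suc m)) (productMass μ)
      ≡⟨ ∑-vecs-suc l m _ ⟩
    ∑ l (λ a → ∑ (vecs l m) (λ v → μ a * productMass μ v))
      ≡⟨ ∑-cong l (λ a → ∑-*ˡ (vecs l m) (μ a) _) ⟩
    ∑ l (λ a → μ a * ∑ (vecs l m) (productMass μ))
      ≡⟨ ∑-cong l (λ a → trans (cong (μ a *_) (productMass-total m)) (*-identityʳ (μ a))) ⟩
    ∑ l μ
      ≡⟨ Dist.total D ⟩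
    1ℚ
      ∎
    where open ≡-Reasoning

iid : {l : List A} → Dist A l → (m : ℕ) → Dist (Vec A m) (vecs l m)
iid D m = record
  { mass   = productMass (Dist.mass D)
  ; nonneg = productMass-nonneg D
  ; total  = productMass-total D m
  }

module _ {l : List A} (D : Dist A l) where

  𝔼-iid-zero : ∀ F → 𝔼 (iid D 0) F ≡ F []
  𝔼-iid-zero F = trans (+-identityʳ _) (*-identityˡ (F []))

  𝔼-iid-suc : ∀ m F → 𝔼 (iid D (suc m)) F ≡ 𝔼 D (λ a → 𝔼 (iid D m) (λ v → F (a ∷ v)))
  𝔼-iid-suc m F = trans (∑-vecs-suc l m _) (∑-cong l (λ a →
    trans (∑-cong (vecs l m) (λ v → *-assoc (Dist.mass D a) _ _)) (∑-*ˡ (vecs l m) (Dist.mass D a) _)))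

  𝔼-iid-++ : ∀ p q F → 𝔼 (iid D (p ℕ.+ q)) F ≡ 𝔼 (iid D p) (λ x → 𝔼 (iid D q) (λ y → F (x ++ y)))
  𝔼-iid-++ zero    q F = sym (𝔼-iid-zero (λ x → 𝔼 (iid D q) (λ y → F (x ++ y))))
  𝔼-iid-++ (suc p) q F = begin
    𝔼 (iid D (suc p ℕ.+ q)) F
      ≡⟨ 𝔼-iid-suc (p ℕ.+ q) F ⟩
    𝔼 D (λ a → 𝔼 (iid D (p ℕ.+ q)) (λ v → F (a ∷ v)))
      ≡⟨ 𝔼-cong D (λ a → 𝔼-iid-++ p q (λ v → F (a ∷ v))) ⟩
    𝔼 D (λ a → 𝔼 (iid D p) (λ x → 𝔼 (iid D q) (λ y → F ((a ∷ x) ++ y))))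
      ≡⟨ 𝔼-iid-suc p _ ⟨
    𝔼 (iid D (suc p)) (λ x → 𝔼 (iid D q) (λ y → F (x ++ y)))
      ∎
    where open ≡-Reasoning

coin : Dist Bool (true ∷ false ∷ [])
coin = record { mass = λ _ → ½ ; nonneg = λ _ → nonNegative⁻¹ ½ ; total = refl }

uniformBits : (n : ℕ) → Dist (Bits n) (allBits n)
uniformBits = iid coin

uniformBlocks : (t m : ℕ) → Dist (Vec (Bits t) m) (allBlocks t m)
uniformBlocks t = iid (uniformBits t)

1/m*n≡1/m*1/n : ∀ m n .{{_ : NonZero m}} .{{_ : NonZero n}} →
                _/_ (+ 1) (m ℕ.* n) {{m*n≢0 m n}} ≡ (+ 1 / m) * (+ 1 / n)
1/m*n≡1/m*1/n (suc a) (suc b)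
  rewrite normalize-coprime {1} {a} (1-coprimeTo (suc a))
        | normalize-coprime {1} {b} (1-coprimeTo (suc b)) = refl

uniformBits-mass : ∀ {n} (x : Bits n) → Dist.mass (uniformBits n) x ≡ _/_ (+ 1) (2 ^ n) {{m^n≢0 2 n}}
uniformBits-mass []              = refl
uniformBits-mass {suc n} (b ∷ x) =
  trans (cong (½ *_) (uniformBits-mass x)) (sym (1/m*n≡1/m*1/n 2 (2 ^ n) {{_}} {{m^n≢0 2 n}}))

PrU-as-𝔼 : ∀ n (f : Bits n → Bool) → PrU n f ≡ 𝔼 (uniformBits n) (λ x → indicator (f x))
PrU-as-𝔼 n f = ∑-cong (allBits n) (λ x → cong (_* indicator (f x)) (sym (uniformBits-mass x)))

indicator-∧ : ∀ a b → indicator (a ∧ b) ≡ indicator a * indicator b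
indicator-∧ true  b = sym (*-identityˡ (indicator b))
indicator-∧ false b = sym (*-zeroˡ (indicator b))

prodU-as-𝔼 : ∀ {w m} t (fs : Vec (UProg w) m) →
             prodU t fs ≡ 𝔼 (uniformBlocks t m) (λ a → indicator (allTrue fs a))
prodU-as-𝔼 t []                    = sym (𝔼-iid-zero (uniformBits t) (λ _ → 1ℚ))
prodU-as-𝔼 {m = suc m} t (f ∷ fs) = begin
  PrU t (run f) * prodU t fs
    ≡⟨ cong₂ _*_ (PrU-as-𝔼 t (run f)) (prodU-as-𝔼 t fs) ⟩
  𝔼 U (λ x → indicator (run f x)) * 𝔼 V (λ v → indicator (allTrue fs v))
    ≡⟨ 𝔼-*ʳ U _ _ ⟨
  𝔼 U (λ x → indicator (run f x) * 𝔼 V (λ v → indicator (allTrue fs v)))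
    ≡⟨ 𝔼-cong U (λ x → 𝔼-*ˡ V (indicator (run f x)) (λ v → indicator (allTrue fs v))) ⟨
  𝔼 U (λ x → 𝔼 V (λ v → indicator (run f x) * indicator (allTrue fs v)))
    ≡⟨ 𝔼-cong U (λ x → 𝔼-cong V (λ v → indicator-∧ (run f x) (allTrue fs v))) ⟨
  𝔼 U (λ x → 𝔼 V (λ v → indicator (allTrue (f ∷ fs) (x ∷ v))))
    ≡⟨ 𝔼-iid-suc U m _ ⟨
  𝔼 (uniformBlocks t (suc m)) (λ a → indicator (allTrue (f ∷ fs) a))
    ∎
  where
  open ≡-Reasoning
  U = uniformBits t
  V = uniformBlocks t m

SimFools⇒𝔼-close : ∀ {m t w ε} (X : Dist (Vec (Bits t) m) (allBlocks t m)) → SimFools m t w X ε →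
  (fs : Vec (UProg w) m) →
  Close (𝔼 X (λ a → indicator (allTrue fs a))) (𝔼 (uniformBlocks t m) (λ a → indicator (allTrue fs a))) ε
SimFools⇒𝔼-close {t = t} {ε = ε} X X-fools fs =
  subst (λ p → Close (𝔼 X (λ a → indicator (allTrue fs a))) p ε) (prodU-as-𝔼 t fs) (X-fools fs)

uniformBits-interleave : ∀ t m (F : Bits (m ℕ.* (t ℕ.+ t)) → ℚ) →
  𝔼 (uniformBits (m ℕ.* (t ℕ.+ t))) F ≡
  𝔼 (uniformBlocks t m) (λ a → 𝔼 (uniformBlocks t m) (λ b → F (interleave a b)))
uniformBits-interleave t zero F = trans (𝔼-iid-zero coin F) (sym (trans
  (𝔼-iid-zero (uniformBits t) (λ a → 𝔼 (uniformBlocks t 0) (λ b → F (interleave a b))))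
  (𝔼-iid-zero (uniformBits t) (λ b → F (interleave [] b)))))
uniformBits-interleave t (suc m) F = begin
  𝔼 (uniformBits ((t ℕ.+ t) ℕ.+ M)) F
    ≡⟨ 𝔼-iid-++ coin (t ℕ.+ t) M F ⟩
  𝔼 (uniformBits (t ℕ.+ t)) (λ u → 𝔼 (uniformBits M) (λ v → F (u ++ v)))
    ≡⟨ 𝔼-iid-++ coin t t _ ⟩
  𝔼 U (λ x → 𝔼 U (λ y → 𝔼 (uniformBits M) (λ v → F ((x ++ y) ++ v))))
    ≡⟨ 𝔼-cong U (λ x → 𝔼-cong U (λ y → uniformBits-interleave t m _)) ⟩
  𝔼 U (λ x → 𝔼 U (λ y → 𝔼 V (λ a → 𝔼 V (λ b → F (interleave (x ∷ a) (y ∷ b))))))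
    ≡⟨ 𝔼-cong U (λ x → 𝔼-swap U V _) ⟩
  𝔼 U (λ x → 𝔼 V (λ a → 𝔼 U (λ y → 𝔼 V (λ b → F (interleave (x ∷ a) (y ∷ b))))))
    ≡⟨ 𝔼-cong U (λ x → 𝔼-cong V (λ a → 𝔼-iid-suc U m _)) ⟨
  𝔼 U (λ x → 𝔼 V (λ a → 𝔼 (uniformBlocks t (suc m)) (λ b → F (interleave (x ∷ a) b))))
    ≡⟨ 𝔼-iid-suc U m _ ⟨
  𝔼 (uniformBlocks t (suc m)) (λ a → 𝔼 (uniformBlocks t (suc m)) (λ b → F (interleave a b)))
    ∎
  where
  open ≡-Reasoning
  M = m ℕ.* (t ℕ.+ t)
  U = uniformBits t
  V = uniformBlocks t m

PrInterleave-as-𝔼 : ∀ {t m} (X Y : Dist (Vec (Bits t) m) (allBlocks t m)) f →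
  PrInterleave X Y f ≡ 𝔼 X (λ a → 𝔼 Y (λ b → indicator (f (interleave a b))))
PrInterleave-as-𝔼 {t} {m} X Y f = ∑-cong (allBlocks t m) (λ a → trans
  (∑-cong (allBlocks t m) (λ b → *-assoc (Dist.mass X a) (Dist.mass Y b) (indicator (f (interleave a b)))))
  (∑-*ˡ (allBlocks t m) (Dist.mass X a) _))

-- Unanimity programs

∧-regroup : ∀ a b c d → (a ∧ b) ∧ (c ∧ d) ≡ a ∧ ((b ∧ c) ∧ d)
∧-regroup a b c d = trans (∧-assoc a b (c ∧ d)) (cong (a ∧_) (sym (∧-assoc b c d)))

module _ {w : ℕ} (B : UProg w) where

  S-++ : ∀ {i k l} q (x : Bits k) (y : Bits l) → S B i q (x ++ y) ≡ S B (i ℕ.+ k) (S B i q x) y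
  S-++ {i}         q []      y = cong (λ j → S B j q y) (sym (ℕₚ.+-identityʳ i))
  S-++ {i} {suc k} q (b ∷ x) y =
    trans (S-++ (P B i q b) x y) (cong (λ j → S B j (S B (suc i) (P B i q b) x) y) (sym (ℕₚ.+-suc i k)))

  accFrom-++ : ∀ {i k l} q (x : Bits k) (y : Bits l) →
               accFrom B i q (x ++ y) ≡ accFrom B i q x ∧ accFrom B (i ℕ.+ k) (S B i q x) y
  accFrom-++ {i}         q []      y = cong (λ j → accFrom B j q y) (sym (ℕₚ.+-identityʳ i))
  accFrom-++ {i} {suc k} q (b ∷ x) y = begin
    a ∧ accFrom B (suc i) s (x ++ y)
      ≡⟨ cong (a ∧_) (accFrom-++ s x y) ⟩
    a ∧ (accFrom B (suc i) s x ∧ accFrom B (suc (i ℕ.+ k)) (S B (suc i) s x) y)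
      ≡⟨ ∧-assoc a _ _ ⟨
    (a ∧ accFrom B (suc i) s x) ∧ accFrom B (suc (i ℕ.+ k)) (S B (suc i) s x) y
      ≡⟨ cong (λ j → (a ∧ accFrom B (suc i) s x) ∧ accFrom B j (S B (suc i) s x) y) (sym (ℕₚ.+-suc i k)) ⟩
    (a ∧ accFrom B (suc i) s x) ∧ accFrom B (i ℕ.+ suc k) (S B (suc i) s x) y
      ∎
    where
    open ≡-Reasoning
    s = P B i q b
    a = acc B (suc i) s

  accFrom-interleave-∷ : ∀ {t m i} q (x y : Bits t) (xs ys : Vec (Bits t) m) →
    accFrom B i q (interleave (x ∷ xs) (y ∷ ys)) ≡
    (accFrom B i q x ∧ accFrom B (i ℕ.+ t) (S B i q x) y) ∧
    accFrom B (i ℕ.+ (t ℕ.+ t)) (S B (i ℕ.+ t) (S B i q x) y) (interleave xs ys)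
  accFrom-interleave-∷ {i = i} q x y xs ys = trans (accFrom-++ q (x ++ y) (interleave xs ys))
    (cong₂ _∧_ (accFrom-++ q x y) (cong (λ s → accFrom B (i ℕ.+ _) s (interleave xs ys)) (S-++ q x y)))

  Reach-S : ∀ {i k q} → Reach B i q → (x : Bits k) → Reach B (i ℕ.+ k) (S B i q x)
  Reach-S (z , refl) x = z ++ x , S-++ (q₀ B) z x

  Reach-S-S : ∀ {i t q} → Reach B i q → (x y : Bits t) →
              Reach B (i ℕ.+ (t ℕ.+ t)) (S B (i ℕ.+ t) (S B i q x) y)
  Reach-S-S {i} {t} {q} rq x y =
    subst (λ j → Reach B j (S B (i ℕ.+ t) (S B i q x) y)) (ℕₚ.+-assoc i t t) (Reach-S (Reach-S rq x) y)

  canonical : ℕ → Fin w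
  canonical i = S B 0 (q₀ B) (replicate i false)

  Reach-canonical : ∀ i → Reach B i (canonical i)
  Reach-canonical i = replicate i false , refl

  block : (T i : ℕ) → Fin w → (Fin w → Bool) → UProg w
  block T i q post = record
    { q₀  = q
    ; P   = λ j → P B (j ℕ.+ i)
    ; acc = λ j s → acc B (j ℕ.+ i) s ∧ (if does (j ℕ.≟ T) then post s else true)
    }

  accFrom-block : ∀ {T i q post k} j s (x : Bits (suc k)) → j ℕ.+ suc k ≡ T →
    accFrom (block T i q post) j s x ≡ accFrom B (j ℕ.+ i) s x ∧ post (S B (j ℕ.+ i) s x)
  accFrom-block {T} {post = post} j s (b ∷ []) j+1≡T
    rewrite dec-true (suc j ℕ.≟ T) (trans (ℕₚ.+-comm 1 j) j+1≡T) =
    trans (∧-identityʳ _) (cong (_∧ post _) (sym (∧-identityʳ _)))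
  accFrom-block {T} {i} {post = post} {suc k} j s (b ∷ x) j+2+k≡T
    with j+2+k≡T′ ← trans (sym (ℕₚ.+-suc j (suc k))) j+2+k≡T
    rewrite dec-false (suc j ℕ.≟ T) (λ j+1≡T → ℕₚ.m+1+n≢m (suc j) (trans j+2+k≡T′ (sym j+1≡T))) =
    trans (cong₂ _∧_ (∧-identityʳ a) (accFrom-block (suc j) s′ x j+2+k≡T′)) (sym (∧-assoc a _ _))
    where
    s′ = P B (j ℕ.+ i) s b
    a = acc B (suc (j ℕ.+ i)) s′

  run-block : ∀ {T} .{{_ : NonZero T}} i q post (x : Bits T) →
              run (block T i q post) x ≡ accFrom B i q x ∧ post (S B i q x)
  run-block {suc k} i q post x = accFrom-block 0 q x refl

-- Sliding-window programs

module SlidingWindow {w : ℕ} (B : UProg w) (t n : ℕ) .{{_ : NonZero t}} (swbp : IsSWBP n t B) where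

  window : ∀ {i q} → Reach B i q → i ℕ.+ t ℕ.≤ n → (x : Bits t) → S B i q x ≡ S B i (canonical B i) x
  window {i} {q} rq i+t≤n x = swbp i i+t≤n x q (canonical B i) rq (Reach-canonical B i)

  private
    rest-fits : ∀ {i m} → i ℕ.+ suc m ℕ.* (t ℕ.+ t) ℕ.≤ n → i ℕ.+ (t ℕ.+ t) ℕ.+ m ℕ.* (t ℕ.+ t) ℕ.≤ n
    rest-fits {i} le = ℕₚ.≤-trans (ℕₚ.≤-reflexive (ℕₚ.+-assoc i (t ℕ.+ t) _)) le

    second-fits : ∀ {i m} → i ℕ.+ suc m ℕ.* (t ℕ.+ t) ℕ.≤ n → i ℕ.+ t ℕ.+ t ℕ.≤ n
    second-fits {i} {m} le = ℕₚ.≤-trans (ℕₚ.≤-reflexive (ℕₚ.+-assoc i t t))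
                                        (ℕₚ.m+n≤o⇒m≤o (i ℕ.+ (t ℕ.+ t)) (rest-fits {i} {m} le))

    first-fits : ∀ {i m} → i ℕ.+ suc m ℕ.* (t ℕ.+ t) ℕ.≤ n → i ℕ.+ t ℕ.≤ n
    first-fits {i} {m} le = ℕₚ.m+n≤o⇒m≤o (i ℕ.+ t) (second-fits {i} {m} le)

  -- The programs reading x₁, …, xₘ once y₁, …, yₘ are fixed: the one for xₖ starts where
  -- y_{k-1} left B, which by the window property does not depend on x_{k-1}.
  xPrograms : ∀ {m} → ℕ → Fin w → Vec (Bits t) m → Vec (UProg w) m
  xPrograms i q []       = []
  xPrograms i q (y ∷ ys) = block B t i q (λ s → accFrom B (i ℕ.+ t) s y)
                         ∷ xPrograms (i ℕ.+ (t ℕ.+ t)) (S B (i ℕ.+ t) (canonical B (i ℕ.+ t)) y) ys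

  accFrom-interleave-xPrograms : ∀ {m i q} → Reach B i q → i ℕ.+ m ℕ.* (t ℕ.+ t) ℕ.≤ n →
    (a b : Vec (Bits t) m) → accFrom B i q (interleave a b) ≡ allTrue (xPrograms i q b) a
  accFrom-interleave-xPrograms rq le [] [] = refl
  accFrom-interleave-xPrograms {suc m} {i} {q} rq le (x ∷ xs) (y ∷ ys) = begin
    accFrom B i q (interleave (x ∷ xs) (y ∷ ys))
      ≡⟨ accFrom-interleave-∷ B q x y xs ys ⟩
    (accFrom B i q x ∧ accFrom B (i ℕ.+ t) (S B i q x) y) ∧ accFrom B j s (interleave xs ys)
      ≡⟨ cong₂ _∧_ (sym (run-block B i q _ x))
                   (accFrom-interleave-xPrograms (Reach-S-S B rq x y) (rest-fits {i} {m} le) xs ys) ⟩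
    run xBlock x ∧ allTrue (xPrograms j s ys) xs
      ≡⟨ cong (λ s → run xBlock x ∧ allTrue (xPrograms j s ys) xs)
              (window (Reach-S B rq x) (second-fits {i} {m} le) y) ⟩
    allTrue (xPrograms i q (y ∷ ys)) (x ∷ xs)
      ∎
    where
    open ≡-Reasoning
    j = i ℕ.+ (t ℕ.+ t)
    s = S B (i ℕ.+ t) (S B i q x) y
    xBlock = block B t i q (λ s → accFrom B (i ℕ.+ t) s y)

  -- The programs reading y₁, …, yₘ once x₁, …, xₘ are fixed: the one for yₖ starts where xₖ
  -- left B and also checks x_{k+1}; the acceptance of x₁ is left over.
  yPrograms : ∀ {m} → ℕ → Bits t → Vec (Bits t) m → Vec (UProg w) (suc m)
  yPrograms i x []        = block B t (i ℕ.+ t) (S B i (canonical B i) x) (λ _ → true) ∷ []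
  yPrograms i x (x′ ∷ xs) =
    block B t (i ℕ.+ t) (S B i (canonical B i) x) (λ s → accFrom B (i ℕ.+ (t ℕ.+ t)) s x′)
    ∷ yPrograms (i ℕ.+ (t ℕ.+ t)) x′ xs

  accFrom-interleave-yPrograms : ∀ {m i q} → Reach B i q → i ℕ.+ suc m ℕ.* (t ℕ.+ t) ℕ.≤ n →
    (x : Bits t) (xs : Vec (Bits t) m) (b : Vec (Bits t) (suc m)) →
    accFrom B i q (interleave (x ∷ xs) b) ≡ accFrom B i q x ∧ allTrue (yPrograms i x xs) b
  accFrom-interleave-yPrograms {zero} {i} {q} rq le x [] (y ∷ []) = begin
    accFrom B i q (interleave (x ∷ []) (y ∷ []))
      ≡⟨ accFrom-interleave-∷ B q x y [] [] ⟩
    (accX ∧ accFrom B (i ℕ.+ t) (S B i q x) y) ∧ true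
      ≡⟨ cong (λ s → (accX ∧ accFrom B (i ℕ.+ t) s y) ∧ true) (window rq (first-fits {i} {zero} le) x) ⟩
    (accX ∧ accFrom B (i ℕ.+ t) s₀ y) ∧ (true ∧ true)
      ≡⟨ ∧-regroup accX _ true true ⟩
    accX ∧ ((accFrom B (i ℕ.+ t) s₀ y ∧ true) ∧ true)
      ≡⟨ cong (λ c → accX ∧ (c ∧ true)) (sym (run-block B (i ℕ.+ t) s₀ _ y)) ⟩
    accX ∧ allTrue (yPrograms i x []) (y ∷ [])
      ∎
    where
    open ≡-Reasoning
    accX = accFrom B i q x
    s₀ = S B i (canonical B i) x
  accFrom-interleave-yPrograms {suc m} {i} {q} rq le x (x′ ∷ xs) (y ∷ ys) = begin
    accFrom B i q (interleave (x ∷ x′ ∷ xs) (y ∷ ys))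
      ≡⟨ accFrom-interleave-∷ B q x y (x′ ∷ xs) ys ⟩
    (accX ∧ accY (S B i q x)) ∧ accFrom B j (S B (i ℕ.+ t) (S B i q x) y) (interleave (x′ ∷ xs) ys)
      ≡⟨ cong ((accX ∧ accY (S B i q x)) ∧_)
              (accFrom-interleave-yPrograms (Reach-S-S B rq x y) (rest-fits {i} {suc m} le) x′ xs ys) ⟩
    (accX ∧ accY (S B i q x)) ∧ (accX′ (S B i q x) ∧ rest)
      ≡⟨ cong (λ s → (accX ∧ accY s) ∧ (accX′ s ∧ rest)) (window rq (first-fits {i} {suc m} le) x) ⟩
    (accX ∧ accY s₀) ∧ (accX′ s₀ ∧ rest)
      ≡⟨ ∧-regroup accX _ _ rest ⟩
    accX ∧ ((accY s₀ ∧ accX′ s₀) ∧ rest)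
      ≡⟨ cong (λ c → accX ∧ (c ∧ rest)) (sym (run-block B (i ℕ.+ t) s₀ _ y)) ⟩
    accX ∧ allTrue (yPrograms i x (x′ ∷ xs)) (y ∷ ys)
      ∎
    where
    open ≡-Reasoning
    j = i ℕ.+ (t ℕ.+ t)
    accX = accFrom B i q x
    accY = λ s → accFrom B (i ℕ.+ t) s y
    accX′ = λ s → accFrom B j (S B (i ℕ.+ t) s y) x′
    s₀ = S B i (canonical B i) x
    rest = allTrue (yPrograms j x′ xs) ys

  fixedY-fooled : ∀ {m} → m ℕ.* (t ℕ.+ t) ℕ.≤ n → (X : Dist (Vec (Bits t) m) (allBlocks t m)) {ε : ℚ} →
    SimFools m t w X ε → ∀ b →
    Close (𝔼 X (λ a → indicator (run B (interleave a b))))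
          (𝔼 (uniformBlocks t m) (λ a → indicator (run B (interleave a b)))) ε
  fixedY-fooled {m} le X {ε} X-fools b = subst₂ (λ p q → Close p q ε)
    (𝔼-cong X (λ a → sym (as-programs a))) (𝔼-cong (uniformBlocks t m) (λ a → sym (as-programs a)))
    (SimFools⇒𝔼-close X X-fools (xPrograms 0 (q₀ B) b))
    where
    as-programs : ∀ a → indicator (run B (interleave a b)) ≡ indicator (allTrue (xPrograms 0 (q₀ B) b) a)
    as-programs a = cong indicator (accFrom-interleave-xPrograms ([] , refl) le a b)

  fixedX-fooled : ∀ {m} → suc m ℕ.* (t ℕ.+ t) ℕ.≤ n →
    (Y : Dist (Vec (Bits t) (suc m)) (allBlocks t (suc m))) {ε : ℚ} →
    0ℚ ≤ ε → SimFools (suc m) t w Y ε → ∀ a →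
    Close (𝔼 Y (λ b → indicator (run B (interleave a b))))
          (𝔼 (uniformBlocks t (suc m)) (λ b → indicator (run B (interleave a b)))) ε
  fixedX-fooled {m} le Y {ε} ε≥0 Y-fools (x ∷ xs) = subst₂ (λ p q → Close p q ε)
    (𝔼-cong Y (λ b → sym (as-programs b))) (𝔼-cong U (λ b → sym (as-programs b)))
    (𝔼-close-∧ Y U ε≥0 (run B x) (SimFools⇒𝔼-close Y Y-fools (yPrograms 0 x xs)))
    where
    U = uniformBlocks t (suc m)
    as-programs : ∀ b → indicator (run B (interleave (x ∷ xs) b))
                      ≡ indicator (run B x ∧ allTrue (yPrograms 0 x xs) b)
    as-programs b = cong indicator (accFrom-interleave-yPrograms ([] , refl) le x xs b)

lemma4p8 : (m t w : ℕ) → .{{NonZero m}} → .{{NonZero t}} → .{{NonZero w}} →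
           (ε : ℚ) → Positive ε →
           (X Y : Dist (Vec (Bits t) m) (allBlocks t m)) →
           SimFools m t w X ε → SimFools m t w Y ε →
           (B : UProg w) → IsSWBP (m ℕ.* (t ℕ.+ t)) t B →
           Close (PrInterleave X Y (run B)) (PrU (m ℕ.* (t ℕ.+ t)) (run B)) ((+ 2 / 1) * ε)
lemma4p8 (suc m) t w ε ε>0 X Y X-fools Y-fools B swbp =
  subst₂ (λ p q → Close p q ((+ 2 / 1) * ε))
    (sym (PrInterleave-as-𝔼 X Y (run B)))
    (sym (trans (PrU-as-𝔼 n (run B)) (uniformBits-interleave t (suc m) (λ z → indicator (run B z)))))
    (subst (Close (𝔼 X (λ a → 𝔼 Y (g a))) (𝔼 U (λ a → 𝔼 U (g a)))) ε+ε≡2ε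
      (hybrid X U Y U g (fixedY-fooled ℕₚ.≤-refl X X-fools) (fixedX-fooled ℕₚ.≤-refl Y ε≥0 Y-fools)))
  where
  n = suc m ℕ.* (t ℕ.+ t)
  open SlidingWindow B t n swbp
  U = uniformBlocks t (suc m)
  g : Vec (Bits t) (suc m) → Vec (Bits t) (suc m) → ℚ
  g a b = indicator (run B (interleave a b))
  ε≥0 : 0ℚ ≤ ε
  ε≥0 = <⇒≤ (positive⁻¹ ε {{ε>0}})
  ε+ε≡2ε : ε + ε ≡ (+ 2 / 1) * ε
  ε+ε≡2ε = sym (trans (*-distribʳ-+ ε 1ℚ 1ℚ) (cong₂ _+_ (*-identityˡ ε) (*-identityˡ ε)))
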